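{- Let $n\ge 1$ and let $\mathbf{d}=(d_1,\dots,d_{n-1})$ be a Dyck path on an $n\times n$ board with bounce number $|\mathbf{m}|=3$, and let $P=P(\mathbf{d})$ be the associated natural unit interval order on $[n]$. Let $a=|S_3|$, $b=|S_2|$ and $k=a+b$. For any nonnegative integers $l,j$ with $3l+2j\le n$: if there exists a $P$-tableau of shape $3^l2^j1^{n-3l-2j}$, then $2l+j\le k$.
   Context: A Dyck path on an $n\times n$ board is a sequence $\mathbf{d}=(d_1,\dots,d_{n-1})$ of positive integers with $d_1\le d_2\le\cdots\le d_{n-1}\le n$ and $d_i\ge i$ for all $i$. The poset $P(\mathbf{d})$ on $[n]$ has relations $i\prec j$ if and only if $i<n$ and $j\in\{d_i+1,\dots,n\}$ (such posets are exactly the natural unit interval orders). The bounce sequence $\mathbf{m}=(m_0,m_1,\dots,m_l)$ is defined by $m_0=d_1$, $m_i=d_{m_{i-1}+1}$ recursively, stopping when $m_l=n$; the bounce number is $|\mathbf{m}|=l+1$. When $|\mathbf{m}|=3$, so $\mathbf{m}=(m_0,m_1,n)$, set $S_1=\{1,\dots,m_0\}$, $S_2=\{m_0+1,\dots,m_1\}$, $S_3=\{m_1+1,\dots,n\}$. A $P$-tableau of shape $\lambda$ is a filling of the Young diagram of $\lambda$ (English convention; $a_{i,j}$ is the entry in row $i$, column $j$) using each element of $P$ exactly once, such that $a_{i,j}\prec a_{i,j+1}$ for all $i,j$ and $a_{i+1,j}\not\prec a_{i,j}$ for all $i,j$. The shape $3^l2^j1^{r}$ denotes the partition with $l$ parts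 equal to $3$, $j$ parts equal to $2$ and $r$ parts equal to $1$. -}

module Defs where

open import Data.Nat using (ℕ; zero; suc; _+_; _*_; _∸_; _≤_; _<_; _<ᵇ_)
open import Data.Bool using (if_then_else_)
open import Data.Product using (_×_; Σ; ∃-syntax)
open import Relation.Binary.PropositionalEquality using (_≡_)
open import Relation.Nullary using (¬_)

-- A Dyck path on an n×n board, given as a function d : ℕ → ℕ of which only the
-- values d 1, …, d (n-1) are meaningful (other values are ignored everywhere).
record IsDyckPath (n : ℕ) (d : ℕ → ℕ) : Set where
  field
    bounds : ∀ i → 1 ≤ i → i < n → i ≤ d i × d i ≤ n
    mono   : ∀ i → 1 ≤ i → suc i < n → d i ≤ d (suc i)

-- d extended by the convention d_i = n for i ≥ n (used by the bounce recursion
-- when some m_{i-1} = n - 1).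
dExt : ℕ → (ℕ → ℕ) → ℕ → ℕ
dExt n d i = if i <ᵇ n then d i else n

m₀ : ℕ → (ℕ → ℕ) → ℕ
m₀ n d = dExt n d 1

m₁ : ℕ → (ℕ → ℕ) → ℕ
m₁ n d = dExt n d (suc (m₀ n d))

m₂ : ℕ → (ℕ → ℕ) → ℕ
m₂ n d = dExt n d (suc (m₁ n d))

-- Bounce number equals 3: m = (m₀, m₁, n), i.e. m₀ < n, m₁ < n, m₂ = n.
-- (Requires 1 < n so that d_1 exists.)
BounceNumber3 : ℕ → (ℕ → ℕ) → Set
BounceNumber3 n d = (1 < n) × (m₀ n d < n) × (m₁ n d < n) × (m₂ n d ≡ n)

sizeS₃ sizeS₂ : ℕ → (ℕ → ℕ) → ℕ
sizeS₃ n d = n ∸ m₁ n d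
sizeS₂ n d = m₁ n d ∸ m₀ n d

_≺[_,_]_ : ℕ → ℕ → (ℕ → ℕ) → ℕ → Set
x ≺[ n , d ] y = (1 ≤ x) × (x < n) × (d x < y) × (y ≤ n)

-- Row lengths of the shape 3^l 2^j 1^r (rows indexed from 0).
rowLen : ℕ → ℕ → ℕ → ℕ
rowLen l j i = if i <ᵇ l then 3 else (if i <ᵇ (l + j) then 2 else 1)

Cell : ℕ → (ℕ → ℕ) → ℕ → ℕ → Set
Cell rows len i c = (i < rows) × (c < len i)

-- A P(d)-tableau of the given shape: a filling T (T i c = entry in row i,
-- column c) using each element of [n] exactly once, with rows strictly
-- increasing in ≺ and a_{i+1,c} ⊀ a_{i,c}.
record IsPTableau (n : ℕ) (d : ℕ → ℕ) (rows : ℕ) (len : ℕ → ℕ)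
                  (T : ℕ → ℕ → ℕ) : Set where
  field
    inRange  : ∀ i c → Cell rows len i c → 1 ≤ T i c × T i c ≤ n
    injective : ∀ i c i' c' → Cell rows len i c → Cell rows len i' c' →
                T i c ≡ T i' c' → (i ≡ i') × (c ≡ c')
    surjective : ∀ x → 1 ≤ x → x ≤ n → ∃[ i ] ∃[ c ] (Cell rows len i c × T i c ≡ x)
    rowChain : ∀ i c → Cell rows len i (suc c) → T i c ≺[ n , d ] T i (suc c)
    colCond  : ∀ i c → Cell rows len (suc i) c → ¬ (T (suc i) c ≺[ n , d ] T i c)

module Submission where

open import Defs
open import Data.Nat using (ℕ; _+_; _*_; _∸_; _≤_)
open import Data.Product using (∃-syntax)

open import Data.Nat using (suc; _<_; _<ᵇ_; _≤′_; ≤′-refl; ≤′-step; s≤s)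
open import Data.Nat.Properties
open import Data.Nat.Solver using (module +-*-Solver)
open import Data.Bool using (true; false)
open import Data.Bool.Properties using (T-≡)
open import Data.Fin using (Fin; toℕ; fromℕ<; splitAt; join)
import Data.Fin.Properties as Fin
open import Data.Product using (_,_; proj₁; proj₂)
open import Data.Sum using (_⊎_; inj₁; inj₂)
open import Function.Bundles using (Equivalence)
open import Function.Definitions using (Injective)
open import Relation.Binary.PropositionalEquality

-- The 2l + j cells outside the first column of a tableau of shape 3^l 2^j 1^r
-- are filled injectively, and each of their entries y has a ≺-predecessor x,
-- so y > d_x ≥ d_1 = m₀. Hence 2l + j ≤ n - m₀ = |S₃| + |S₂|.

∸-triangle : ∀ n a b → n ∸ b ≤ (n ∸ a) + (a ∸ b)
∸-triangle n a b = m≤n+o⇒m∸n≤o n b (begin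
  n                           ≤⟨ m≤n+m∸n n a ⟩
  a + (n ∸ a)                 ≤⟨ +-monoˡ-≤ (n ∸ a) (m≤n+m∸n a b) ⟩
  b + (a ∸ b) + (n ∸ a)       ≡⟨ +-assoc b (a ∸ b) (n ∸ a) ⟩
  b + ((a ∸ b) + (n ∸ a))     ≡⟨ cong (b +_) (+-comm (a ∸ b) (n ∸ a)) ⟩
  b + ((n ∸ a) + (a ∸ b))     ∎)
  where open ≤-Reasoning

injective-into-interval⇒≤ : ∀ {k m n} (f : Fin k → ℕ) → Injective _≡_ _≡_ f →
                            (∀ t → m < f t) → (∀ t → f t ≤ n) → k ≤ n ∸ m
injective-into-interval⇒≤ {k} {m} {n} f f-inj m<f f≤n = Fin.injective⇒≤ g-inj
  where
  g : Fin k → Fin (n ∸ m)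
  g t = fromℕ< (∸-monoˡ-< (s≤s (f≤n t)) (m<f t))

  g-inj : Injective _≡_ _≡_ g
  g-inj {t} {t′} g≡ = f-inj (∸-cancelʳ-≡ (m<f t) (m<f t′) (begin
    f t ∸ suc m         ≡⟨ Fin.toℕ-fromℕ< _ ⟨
    toℕ (g t)           ≡⟨ cong toℕ g≡ ⟩
    toℕ (g t′)          ≡⟨ Fin.toℕ-fromℕ< _ ⟩
    f t′ ∸ suc m        ∎))
    where open ≡-Reasoning

dyck-mono : ∀ {n d} → IsDyckPath n d → ∀ {i k} → 1 ≤ i → i ≤ k → k < n → d i ≤ d k
dyck-mono {n} {d} D 1≤i i≤k = go (≤⇒≤′ i≤k)
  where
  go : ∀ {k} → _ ≤′ k → k < n → d _ ≤ d k
  go ≤′-refl          _   = ≤-refl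
  go (≤′-step i≤′k) k<n =
    ≤-trans (go i≤′k (<-trans (n<1+n _) k<n))
            (IsDyckPath.mono D _ (≤-trans 1≤i (≤′⇒≤ i≤′k)) k<n)

≺⇒d₁< : ∀ {n d x y} → IsDyckPath n d → x ≺[ n , d ] y → d 1 < y
≺⇒d₁< D (1≤x , x<n , dx<y , _) = ≤-<-trans (dyck-mono D ≤-refl 1≤x x<n) dx<y

<⇒<ᵇ≡true : ∀ {m n} → m < n → (m <ᵇ n) ≡ true
<⇒<ᵇ≡true m<n = Equivalence.to T-≡ (<⇒<ᵇ m<n)

m₀≡d₁ : ∀ n d → 1 < n → m₀ n d ≡ d 1
m₀≡d₁ n d 1<n rewrite <⇒<ᵇ≡true 1<n = refl

rowLen≡3 : ∀ {l} j {i} → i < l → rowLen l j i ≡ 3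
rowLen≡3 {l} j {i} i<l rewrite <⇒<ᵇ≡true i<l = refl

rowLen≥2 : ∀ l j {i} → i < l + j → 2 ≤ rowLen l j i
rowLen≥2 l j {i} i<l+j with i <ᵇ l
... | true  = s≤s (s≤s (n≤1+n 0))
... | false rewrite <⇒<ᵇ≡true i<l+j = ≤-refl

splitAt-injective : ∀ m n → Injective _≡_ _≡_ (splitAt m {n})
splitAt-injective m n {i} {i′} e = begin
  i                         ≡⟨ Fin.join-splitAt m n i ⟨
  join m n (splitAt m i)    ≡⟨ cong (join m n) e ⟩
  join m n (splitAt m i′)   ≡⟨ Fin.join-splitAt m n i′ ⟩
  i′                        ∎
  where open ≡-Reasoning

module UpperCells {n d rows l j T} (D : IsDyckPath n d)
                  (PT : IsPTableau n d rows (rowLen l j) T) (l+j≤rows : l + j ≤ rows) where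
  open IsPTableau PT

  upperEntry : Fin (l + j) ⊎ Fin l → ℕ
  upperEntry (inj₁ i) = T (toℕ i) 1
  upperEntry (inj₂ i) = T (toℕ i) 2

  column1 : ∀ (i : Fin (l + j)) → Cell rows (rowLen l j) (toℕ i) 1
  column1 i = ≤-trans (Fin.toℕ<n i) l+j≤rows , rowLen≥2 l j (Fin.toℕ<n i)

  column2 : ∀ (i : Fin l) → Cell rows (rowLen l j) (toℕ i) 2
  column2 i = ≤-trans (≤-trans (Fin.toℕ<n i) (m≤m+n l j)) l+j≤rows
            , ≤-reflexive (sym (rowLen≡3 j (Fin.toℕ<n i)))

  upperEntry-injective : Injective _≡_ _≡_ upperEntry
  upperEntry-injective {inj₁ i} {inj₁ i′} e =
    cong inj₁ (Fin.toℕ-injective (proj₁ (injective _ _ _ _ (column1 i) (column1 i′) e)))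
  upperEntry-injective {inj₁ i} {inj₂ i′} e
    with () ← proj₂ (injective _ _ _ _ (column1 i) (column2 i′) e)
  upperEntry-injective {inj₂ i} {inj₁ i′} e
    with () ← proj₂ (injective _ _ _ _ (column2 i) (column1 i′) e)
  upperEntry-injective {inj₂ i} {inj₂ i′} e =
    cong inj₂ (Fin.toℕ-injective (proj₁ (injective _ _ _ _ (column2 i) (column2 i′) e)))

  d₁<upperEntry : ∀ p → d 1 < upperEntry p
  d₁<upperEntry (inj₁ i) = ≺⇒d₁< D (rowChain _ 0 (column1 i))
  d₁<upperEntry (inj₂ i) = ≺⇒d₁< D (rowChain _ 1 (column2 i))

  upperEntry≤n : ∀ p → upperEntry p ≤ n
  upperEntry≤n (inj₁ i) = proj₂ (inRange _ _ (column1 i))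
  upperEntry≤n (inj₂ i) = proj₂ (inRange _ _ (column2 i))

  upperCells≤n∸d₁ : l + j + l ≤ n ∸ d 1
  upperCells≤n∸d₁ = injective-into-interval⇒≤ upperEntryAt
    (λ {t} {t′} e → splitAt-injective (l + j) l
                      (upperEntry-injective {splitAt (l + j) t} {splitAt (l + j) t′} e))
    (λ t → d₁<upperEntry (splitAt (l + j) t))
    (λ t → upperEntry≤n (splitAt (l + j) t))
    where
    upperEntryAt : Fin (l + j + l) → ℕ
    upperEntryAt t = upperEntry (splitAt (l + j) t)

2l+j≡l+j+l : ∀ l j → 2 * l + j ≡ l + j + l
2l+j≡l+j+l = solve 2 (λ l j → con 2 :* l :+ j := l :+ j :+ l) refl
  where open +-*-Solver

lemma3p2 : (n : ℕ) → 1 ≤ n → (d : ℕ → ℕ) → IsDyckPath n d → BounceNumber3 n d →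
    (l j : ℕ) → 3 * l + 2 * j ≤ n →
    (∃[ T ] IsPTableau n d (l + j + (n ∸ (3 * l + 2 * j))) (rowLen l j) T) →
    2 * l + j ≤ sizeS₃ n d + sizeS₂ n d
lemma3p2 n _ d D (1<n , _) l j _ (T , PT) = begin
  2 * l + j                        ≡⟨ 2l+j≡l+j+l l j ⟩
  l + j + l                        ≤⟨ UpperCells.upperCells≤n∸d₁ {l = l} {j = j} D PT (m≤m+n (l + j) _) ⟩
  n ∸ d 1                          ≡⟨ cong (n ∸_) (m₀≡d₁ n d 1<n) ⟨
  n ∸ m₀ n d                       ≤⟨ ∸-triangle n (m₁ n d) (m₀ n d) ⟩
  sizeS₃ n d + sizeS₂ n d          ∎
  where open ≤-Reasoning
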